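{- Let $W=\langle W,\cdot,1_W\rangle$ be a monoid. The category $\mathbf{Dec}_W$ of decorated functors is a strict monoidal category with the following data: the tensor unit is the identity functor $\mathbb 1$ with decoration $\mathrm{dec}_{\mathbb 1}=\mathrm{ret}_{W\times}:A\to W\times A$, $a\mapsto(1_W,a)$; the tensor product of decorated functors $(T_1,\mathrm{dec}_{T_1})$ and $(T_2,\mathrm{dec}_{T_2})$ is the composite functor $T_1\circ T_2$ with decoration $$\mathrm{dec}_{T_1\circ T_2}:=\mathrm{map}_{T_1}\big(\mathrm{map}_{T_2}(\mathrm{join}_{W\times})\circ\sigma_{T_2}\big)\circ\mathrm{dec}_{T_1}\circ\mathrm{map}_{T_1}(\mathrm{dec}_{T_2}) : T_1T_2A\to T_1T_2(W\times A),$$ and the tensor of morphisms is horizontal composition of natural transformations. (In particular these unit and composite decorations satisfy the decorated functor axioms.)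
   Context: All functors are endofunctors of $\mathbf{Set}$; $\mathrm{map}_F$ is the functor action. On $W\times-$: $\mathrm{extr}(w,a)=a$, $\mathrm{dup}(w,a)=(w,(w,a))$, $\mathrm{ret}_{W\times}(a)=(1_W,a)$, $\mathrm{join}_{W\times}(w_1,(w_2,a))=(w_1\cdot w_2,a)$. For a functor $G$, the strength $\sigma_G:W\times GA\to G(W\times A)$ is $\sigma_G(w,x)=\mathrm{map}_G(\lambda a.(w,a))x$. A decorated functor is a functor $T$ with a natural transformation $\mathrm{dec}_T:TA\to T(W\times A)$ satisfying $\mathrm{map}_T\mathrm{extr}\circ\mathrm{dec}_T=\mathrm{id}$ and $\mathrm{map}_T\mathrm{dup}\circ\mathrm{dec}_T=\mathrm{dec}_T\circ\mathrm{dec}_T$ (the second $\mathrm{dec}_T$ at $W\times A$). $\mathbf{Dec}_W$ has decorated functors as objects and, as morphisms $T_1\Rightarrow T_2$, natural transformations $\psi$ with $\psi_{W\times A}\circ\mathrm{dec}_{T_1}=\mathrm{dec}_{T_2}\circ\psi_A$. -}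

module Defs where

open import Data.Product using (_×_; _,_; proj₁; proj₂)
open import Function using (_∘_; id)
open import Relation.Binary.PropositionalEquality using (_≡_; refl; trans; cong)

-- Equations between functions are stated
-- pointwise (no function extensionality); map-cong records that the action
-- respects extensional equality of functions, as every functor on Set does.
record Functor : Set₁ where
  field
    F      : Set → Set
    map    : ∀ {A B : Set} → (A → B) → F A → F B
    map-cong : ∀ {A B : Set} {f g : A → B} → (∀ a → f a ≡ g a) → ∀ x → map f x ≡ map g x
    map-id : ∀ {A : Set} (x : F A) → map id x ≡ x
    map-∘  : ∀ {A B C : Set} (g : B → C) (f : A → B) (x : F A) → map (g ∘ f) x ≡ map g (map f x)

open Functor public

IdF : Functor
IdF = record
  { F = λ A → A ; map = λ f → f ; map-cong = λ e x → e x
  ; map-id = λ x → refl ; map-∘ = λ g f x → refl }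

_∘F_ : Functor → Functor → Functor
T₁ ∘F T₂ = record
  { F = λ A → F T₁ (F T₂ A)
  ; map = λ f → map T₁ (map T₂ f)
  ; map-cong = λ e → map-cong T₁ (map-cong T₂ e)
  ; map-id = λ x → trans (map-cong T₁ (map-id T₂) x) (map-id T₁ x)
  ; map-∘ = λ g f x → trans (map-cong T₁ (map-∘ T₂ g f) x) (map-∘ T₁ (map T₂ g) (map T₂ f) x)
  }

hcomp : (T₁ T₁' T₂ T₂' : Functor)
      → (∀ {A} → F T₁ A → F T₁' A) → (∀ {A} → F T₂ A → F T₂' A)
      → ∀ {A} → F T₁ (F T₂ A) → F T₁' (F T₂' A)
hcomp T₁ T₁' T₂ T₂' ψ φ x = ψ (map T₁ φ x)

-- Everything relative to a carrier W with a binary operation and a unit.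
-- (The monoid laws are assumed as a hypothesis in the statement.)
module DecW (W : Set) (_·_ : W → W → W) (1W : W) where

  Wmap : ∀ {A B : Set} → (A → B) → W × A → W × B
  Wmap f p = (proj₁ p , f (proj₂ p))

  extr : ∀ {A : Set} → W × A → A
  extr p = proj₂ p

  dup : ∀ {A : Set} → W × A → W × (W × A)
  dup p = (proj₁ p , p)

  ret : ∀ {A : Set} → A → W × A
  ret a = (1W , a)

  join : ∀ {A : Set} → W × (W × A) → W × A
  join p = (proj₁ p · proj₁ (proj₂ p) , proj₂ (proj₂ p))

  σ : (G : Functor) → ∀ {A : Set} → W × F G A → F G (W × A)
  σ G p = map G (λ a → (proj₁ p , a)) (proj₂ p)

  record IsDecoration (T : Functor) (dec : ∀ {A : Set} → F T A → F T (W × A)) : Set₁ where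
    field
      dec-natural : ∀ {A B : Set} (f : A → B) (x : F T A) → map T (Wmap f) (dec x) ≡ dec (map T f x)
      dec-extr    : ∀ {A : Set} (x : F T A) → map T extr (dec x) ≡ x
      dec-dup     : ∀ {A : Set} (x : F T A) → map T dup (dec x) ≡ dec (dec x)

  record Decorated : Set₁ where
    field
      fun   : Functor
      dec   : ∀ {A : Set} → F fun A → F fun (W × A)
      isDec : IsDecoration fun dec

  open Decorated public

  record IsDecMor (T U : Functor) (decT : ∀ {A : Set} → F T A → F T (W × A))
                  (decU : ∀ {A : Set} → F U A → F U (W × A))
                  (η : ∀ {A : Set} → F T A → F U A) : Set₁ where
    field
      natural    : ∀ {A B : Set} (f : A → B) (x : F T A) → η (map T f x) ≡ map U f (η x)
      dec-compat : ∀ {A : Set} (x : F T A) → η (decT x) ≡ decU (η x)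

  record DecMor (T U : Decorated) : Set₁ where
    field
      η     : ∀ {A : Set} → F (fun T) A → F (fun U) A
      isMor : IsDecMor (fun T) (fun U) (dec T) (dec U) η

  open DecMor public

  decUnit : ∀ {A : Set} → A → W × A
  decUnit = ret

  compDec : (T₁ T₂ : Functor)
          → (∀ {A : Set} → F T₁ A → F T₁ (W × A))
          → (∀ {A : Set} → F T₂ A → F T₂ (W × A))
          → ∀ {A : Set} → F T₁ (F T₂ A) → F T₁ (F T₂ (W × A))
  compDec T₁ T₂ d₁ d₂ x = map T₁ (λ p → map T₂ join (σ T₂ p)) (d₁ (map T₁ d₂ x))

  decT : (T₁ T₂ : Decorated) → ∀ {A : Set} → F (fun T₁) (F (fun T₂) A) → F (fun T₁) (F (fun T₂) (W × A))
  decT T₁ T₂ = compDec (fun T₁) (fun T₂) (dec T₁) (dec T₂)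

  -- The underlying functors of
  -- (T₁∘T₂)∘T₃ and T₁∘(T₂∘T₃), 𝟙∘T, T∘𝟙, T agree definitionally, so strictness
  -- amounts to the equalities of decorations (and of morphisms) below.
  record IsStrictMonoidalDec : Set₁ where
    field
      unit-isDec   : IsDecoration IdF decUnit
      tensor-isDec : (T₁ T₂ : Decorated) → IsDecoration (fun T₁ ∘F fun T₂) (decT T₁ T₂)
      tensor-mor   : (T₁ T₁' T₂ T₂' : Decorated) (ψ : DecMor T₁ T₁') (φ : DecMor T₂ T₂')
                   → IsDecMor (fun T₁ ∘F fun T₂) (fun T₁' ∘F fun T₂') (decT T₁ T₂) (decT T₁' T₂')
                              (hcomp (fun T₁) (fun T₁') (fun T₂) (fun T₂') (η ψ) (η φ))
      tensor-id    : (T₁ T₂ : Decorated) {A : Set} (x : F (fun T₁) (F (fun T₂) A))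
                   → hcomp (fun T₁) (fun T₁) (fun T₂) (fun T₂) id id x ≡ x
      tensor-∘     : (T₁ T₁' T₁'' T₂ T₂' T₂'' : Decorated)
                     (ψ : DecMor T₁ T₁') (ψ' : DecMor T₁' T₁'') (φ : DecMor T₂ T₂') (φ' : DecMor T₂' T₂'')
                     {A : Set} (x : F (fun T₁) (F (fun T₂) A))
                   → hcomp (fun T₁) (fun T₁'') (fun T₂) (fun T₂'') (η ψ' ∘ η ψ) (η φ' ∘ η φ) x
                     ≡ hcomp (fun T₁') (fun T₁'') (fun T₂') (fun T₂'') (η ψ') (η φ')
                         (hcomp (fun T₁) (fun T₁') (fun T₂) (fun T₂') (η ψ) (η φ) x)
      assoc        : (T₁ T₂ T₃ : Decorated) {A : Set} (x : F (fun T₁) (F (fun T₂) (F (fun T₃) A)))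
                   → compDec (fun T₁ ∘F fun T₂) (fun T₃) (decT T₁ T₂) (dec T₃) x
                     ≡ compDec (fun T₁) (fun T₂ ∘F fun T₃) (dec T₁) (decT T₂ T₃) x
      unitˡ        : (T : Decorated) {A : Set} (x : F (fun T) A)
                   → compDec IdF (fun T) decUnit (dec T) x ≡ dec T x
      unitʳ        : (T : Decorated) {A : Set} (x : F (fun T) A)
                   → compDec (fun T) IdF (dec T) decUnit x ≡ dec T x
      assoc-mor    : (T₁ T₁' T₂ T₂' T₃ T₃' : Decorated)
                     (ψ : DecMor T₁ T₁') (φ : DecMor T₂ T₂') (χ : DecMor T₃ T₃')
                     {A : Set} (x : F (fun T₁) (F (fun T₂) (F (fun T₃) A)))
                   → hcomp (fun T₁ ∘F fun T₂) (fun T₁' ∘F fun T₂') (fun T₃) (fun T₃')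
                       (hcomp (fun T₁) (fun T₁') (fun T₂) (fun T₂') (η ψ) (η φ)) (η χ) x
                     ≡ hcomp (fun T₁) (fun T₁') (fun T₂ ∘F fun T₃) (fun T₂' ∘F fun T₃')
                       (η ψ) (hcomp (fun T₂) (fun T₂') (fun T₃) (fun T₃') (η φ) (η χ)) x
      unitˡ-mor    : (T T' : Decorated) (ψ : DecMor T T') {A : Set} (x : F (fun T) A)
                   → hcomp IdF IdF (fun T) (fun T') id (η ψ) x ≡ η ψ x
      unitʳ-mor    : (T T' : Decorated) (ψ : DecMor T T') {A : Set} (x : F (fun T) A)
                   → hcomp (fun T) (fun T') IdF IdF (η ψ) id x ≡ η ψ x

-- Unfolding the definitions, the composite decoration of T₁T₂ is
--   x ↦ map_{T₁} (λ (w , y) → shift_w (dec_{T₂} y)) (dec_{T₁} x),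
-- where shift_w multiplies every label of a T₂-decoration on the left by w:
-- each inner T₂-layer is decorated by T₂, its labels prefixed by the label w
-- of its position in T₁.  For every fixed w, dec_{T₂} followed by shift_w is
-- again a decoration, so the decoration axioms of the composite hold
-- pointwise.  The monoid laws enter only through shift_1 = dec and
-- (relabelling by w ·_) ∘ shift_v = shift_{w·v}, which give the strict unit
-- and associativity laws; Dec-morphisms commute with shift_w, which makes the
-- horizontal composite of Dec-morphisms a Dec-morphism.
module Submission where

open import Algebra.Structures using (IsMonoid)
open import Data.Product using (_×_; _,_; proj₁; proj₂; map₁; uncurry)
open import Function using (_∘_; id)
open import Relation.Binary.PropositionalEquality using (_≡_; refl; sym; trans; cong; module ≡-Reasoning)

open import Defs

open ≡-Reasoning

_⟹_ : Functor → Functor → Set₁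
T ⟹ U = ∀ {A : Set} → F T A → F U A

IsNatural : (T U : Functor) → T ⟹ U → Set₁
IsNatural T U ψ = ∀ {A B : Set} (f : A → B) (x : F T A) → ψ (map T f x) ≡ map U f (ψ x)

hcomp-natural : (T₁ T₁' T₂ T₂' : Functor) {ψ : T₁ ⟹ T₁'} {φ : T₂ ⟹ T₂'}
              → IsNatural T₁ T₁' ψ → IsNatural T₂ T₂' φ
              → IsNatural (T₁ ∘F T₂) (T₁' ∘F T₂') (hcomp T₁ T₁' T₂ T₂' ψ φ)
hcomp-natural T₁ T₁' T₂ T₂' {ψ} {φ} ψ-natural φ-natural f x = begin
  ψ (map T₁ φ (map T₁ (map T₂ f) x))   ≡⟨ cong ψ (map-∘ T₁ φ (map T₂ f) x) ⟨
  ψ (map T₁ (φ ∘ map T₂ f) x)          ≡⟨ cong ψ (map-cong T₁ (φ-natural f) x) ⟩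
  ψ (map T₁ (map T₂' f ∘ φ) x)         ≡⟨ cong ψ (map-∘ T₁ (map T₂' f) φ x) ⟩
  ψ (map T₁ (map T₂' f) (map T₁ φ x))  ≡⟨ ψ-natural (map T₂' f) (map T₁ φ x) ⟩
  map T₁' (map T₂' f) (ψ (map T₁ φ x)) ∎

hcomp-interchange : (T₁ T₁' T₁'' T₂ T₂' T₂'' : Functor)
                    {ψ : T₁ ⟹ T₁'} (ψ' : T₁' ⟹ T₁'') (φ : T₂ ⟹ T₂') (φ' : T₂' ⟹ T₂'')
                  → IsNatural T₁ T₁' ψ
                  → ∀ {A : Set} (x : F T₁ (F T₂ A))
                  → hcomp T₁ T₁'' T₂ T₂'' (ψ' ∘ ψ) (φ' ∘ φ) x
                    ≡ hcomp T₁' T₁'' T₂' T₂'' ψ' φ' (hcomp T₁ T₁' T₂ T₂' ψ φ x)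
hcomp-interchange T₁ T₁' T₁'' T₂ T₂' T₂'' {ψ} ψ' φ φ' ψ-natural x = cong ψ' (begin
  ψ (map T₁ (φ' ∘ φ) x)          ≡⟨ cong ψ (map-∘ T₁ φ' φ x) ⟩
  ψ (map T₁ φ' (map T₁ φ x))     ≡⟨ ψ-natural φ' (map T₁ φ x) ⟩
  map T₁' φ' (ψ (map T₁ φ x))    ∎)

module Decorations (W : Set) (_·_ : W → W → W) (1W : W) where
  open DecW W _·_ 1W public
  open import Algebra.Definitions (_≡_ {A = W}) using (Associative; LeftIdentity; RightIdentity)

  module _ (T : Decorated) where
    open IsDecoration (isDec T)

    dec-map-dec : ∀ {A B : Set} (g : W × A → B) (x : F (fun T) A)
                → dec T (map (fun T) g (dec T x)) ≡ map (fun T) (Wmap g ∘ dup) (dec T x)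
    dec-map-dec g x = begin
      dec T (map (fun T) g (dec T x))            ≡⟨ dec-natural g (dec T x) ⟨
      map (fun T) (Wmap g) (dec T (dec T x))     ≡⟨ cong (map (fun T) (Wmap g)) (dec-dup x) ⟨
      map (fun T) (Wmap g) (map (fun T) dup (dec T x)) ≡⟨ map-∘ (fun T) (Wmap g) dup (dec T x) ⟨
      map (fun T) (Wmap g ∘ dup) (dec T x)       ∎

    shiftDec : ∀ {A : Set} → W → F (fun T) A → F (fun T) (W × A)
    shiftDec w y = map (fun T) (map₁ (w ·_)) (dec T y)

    shiftDec-isDecoration : (w : W) → IsDecoration (fun T) (shiftDec w)
    shiftDec-isDecoration w = record
      { dec-natural = natural ; dec-extr = extracts ; dec-dup = duplicates }
      where
        m : ∀ {A : Set} → W × A → W × A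
        m = map₁ (w ·_)

        natural : ∀ {A B : Set} (f : A → B) (y : F (fun T) A)
                → map (fun T) (Wmap f) (shiftDec w y) ≡ shiftDec w (map (fun T) f y)
        natural f y = begin
          map (fun T) (Wmap f) (map (fun T) m (dec T y)) ≡⟨ map-∘ (fun T) (Wmap f) m (dec T y) ⟨
          map (fun T) (m ∘ Wmap f) (dec T y)             ≡⟨ map-∘ (fun T) m (Wmap f) (dec T y) ⟩
          map (fun T) m (map (fun T) (Wmap f) (dec T y)) ≡⟨ cong (map (fun T) m) (dec-natural f y) ⟩
          map (fun T) m (dec T (map (fun T) f y))        ∎

        extracts : ∀ {A : Set} (y : F (fun T) A) → map (fun T) extr (shiftDec w y) ≡ y
        extracts y = trans (sym (map-∘ (fun T) extr m (dec T y))) (dec-extr y)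

        duplicates : ∀ {A : Set} (y : F (fun T) A)
                   → map (fun T) dup (shiftDec w y) ≡ shiftDec w (shiftDec w y)
        duplicates y = begin
          map (fun T) dup (map (fun T) m (dec T y))        ≡⟨ map-∘ (fun T) dup m (dec T y) ⟨
          map (fun T) (m ∘ Wmap m ∘ dup) (dec T y)         ≡⟨ map-∘ (fun T) m (Wmap m ∘ dup) (dec T y) ⟩
          map (fun T) m (map (fun T) (Wmap m ∘ dup) (dec T y)) ≡⟨ cong (map (fun T) m) (dec-map-dec m y) ⟨
          map (fun T) m (dec T (map (fun T) m (dec T y)))  ∎

    shiftDec-identityˡ : LeftIdentity 1W _·_ → ∀ {A : Set} (y : F (fun T) A) → shiftDec 1W y ≡ dec T y
    shiftDec-identityˡ identityˡ y = begin
      map (fun T) (map₁ (1W ·_)) (dec T y) ≡⟨ map-cong (fun T) (λ p → cong (_, proj₂ p) (identityˡ (proj₁ p))) (dec T y) ⟩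
      map (fun T) id (dec T y)             ≡⟨ map-id (fun T) (dec T y) ⟩
      dec T y                              ∎

    map₁-shiftDec : Associative _·_ → ∀ {A : Set} (w v : W) (y : F (fun T) A)
                  → map (fun T) (map₁ (w ·_)) (shiftDec v y) ≡ shiftDec (w · v) y
    map₁-shiftDec assoc w v y = begin
      map (fun T) (map₁ (w ·_)) (map (fun T) (map₁ (v ·_)) (dec T y))
        ≡⟨ map-∘ (fun T) (map₁ (w ·_)) (map₁ (v ·_)) (dec T y) ⟨
      map (fun T) (map₁ (w ·_) ∘ map₁ (v ·_)) (dec T y)
        ≡⟨ map-cong (fun T) (λ p → cong (_, proj₂ p) (sym (assoc w v (proj₁ p)))) (dec T y) ⟩
      map (fun T) (map₁ ((w · v) ·_)) (dec T y) ∎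

  shiftDec-compat : {T U : Decorated} (ψ : DecMor T U) (w : W) {A : Set} (y : F (fun T) A)
                  → η ψ (shiftDec T w y) ≡ shiftDec U w (η ψ y)
  shiftDec-compat {T} {U} ψ w y = begin
    η ψ (map (fun T) (map₁ (w ·_)) (dec T y)) ≡⟨ IsDecMor.natural (isMor ψ) (map₁ (w ·_)) (dec T y) ⟩
    map (fun U) (map₁ (w ·_)) (η ψ (dec T y)) ≡⟨ cong (map (fun U) (map₁ (w ·_))) (IsDecMor.dec-compat (isMor ψ) y) ⟩
    map (fun U) (map₁ (w ·_)) (dec U (η ψ y)) ∎

  decT-unfold : (T₁ T₂ : Decorated) {A : Set} (x : F (fun T₁) (F (fun T₂) A))
              → decT T₁ T₂ x ≡ map (fun T₁) (uncurry (shiftDec T₂)) (dec T₁ x)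
  decT-unfold T₁ T₂ x = begin
    map P (λ p → map Q join (σ Q p)) (dec T₁ (map P (dec T₂) x))
      ≡⟨ map-cong P (λ p → map-∘ Q join (λ a → (proj₁ p , a)) (proj₂ p)) _ ⟨
    map P (λ p → map Q (map₁ (proj₁ p ·_)) (proj₂ p)) (dec T₁ (map P (dec T₂) x))
      ≡⟨ cong (map P _) (IsDecoration.dec-natural (isDec T₁) (dec T₂) x) ⟨
    map P (λ p → map Q (map₁ (proj₁ p ·_)) (proj₂ p)) (map P (Wmap (dec T₂)) (dec T₁ x))
      ≡⟨ map-∘ P _ (Wmap (dec T₂)) (dec T₁ x) ⟨
    map P (uncurry (shiftDec T₂)) (dec T₁ x) ∎
    where
      P = fun T₁
      Q = fun T₂

  decT-isDecoration : (T₁ T₂ : Decorated) → IsDecoration (fun T₁ ∘F fun T₂) (decT T₁ T₂)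
  decT-isDecoration T₁ T₂ = record
    { dec-natural = natural ; dec-extr = extracts ; dec-dup = duplicates }
    where
      P = fun T₁
      Q = fun T₂
      D = dec T₁
      open IsDecoration (isDec T₁)

      S : ∀ {A : Set} → W × F Q A → F Q (W × A)
      S = uncurry (shiftDec T₂)

      natural : ∀ {A B : Set} (f : A → B) (x : F P (F Q A))
              → map P (map Q (Wmap f)) (decT T₁ T₂ x) ≡ decT T₁ T₂ (map P (map Q f) x)
      natural f x = begin
        map P (map Q (Wmap f)) (decT T₁ T₂ x)        ≡⟨ cong (map P (map Q (Wmap f))) (decT-unfold T₁ T₂ x) ⟩
        map P (map Q (Wmap f)) (map P S (D x))       ≡⟨ map-∘ P (map Q (Wmap f)) S (D x) ⟨
        map P (map Q (Wmap f) ∘ S) (D x)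
          ≡⟨ map-cong P (λ p → IsDecoration.dec-natural (shiftDec-isDecoration T₂ (proj₁ p)) f (proj₂ p)) (D x) ⟩
        map P (S ∘ Wmap (map Q f)) (D x)             ≡⟨ map-∘ P S (Wmap (map Q f)) (D x) ⟩
        map P S (map P (Wmap (map Q f)) (D x))       ≡⟨ cong (map P S) (dec-natural (map Q f) x) ⟩
        map P S (D (map P (map Q f) x))              ≡⟨ decT-unfold T₁ T₂ (map P (map Q f) x) ⟨
        decT T₁ T₂ (map P (map Q f) x)               ∎

      extracts : ∀ {A : Set} (x : F P (F Q A)) → map P (map Q extr) (decT T₁ T₂ x) ≡ x
      extracts x = begin
        map P (map Q extr) (decT T₁ T₂ x)     ≡⟨ cong (map P (map Q extr)) (decT-unfold T₁ T₂ x) ⟩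
        map P (map Q extr) (map P S (D x))    ≡⟨ map-∘ P (map Q extr) S (D x) ⟨
        map P (map Q extr ∘ S) (D x)
          ≡⟨ map-cong P (λ p → IsDecoration.dec-extr (shiftDec-isDecoration T₂ (proj₁ p)) (proj₂ p)) (D x) ⟩
        map P extr (D x)                      ≡⟨ dec-extr x ⟩
        x                                     ∎

      duplicates : ∀ {A : Set} (x : F P (F Q A))
                 → map P (map Q dup) (decT T₁ T₂ x) ≡ decT T₁ T₂ (decT T₁ T₂ x)
      duplicates x = begin
        map P (map Q dup) (decT T₁ T₂ x)      ≡⟨ cong (map P (map Q dup)) (decT-unfold T₁ T₂ x) ⟩
        map P (map Q dup) (map P S (D x))     ≡⟨ map-∘ P (map Q dup) S (D x) ⟨
        map P (map Q dup ∘ S) (D x)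
          ≡⟨ map-cong P (λ p → IsDecoration.dec-dup (shiftDec-isDecoration T₂ (proj₁ p)) (proj₂ p)) (D x) ⟩
        map P (S ∘ Wmap S ∘ dup) (D x)        ≡⟨ map-∘ P S (Wmap S ∘ dup) (D x) ⟩
        map P S (map P (Wmap S ∘ dup) (D x))  ≡⟨ cong (map P S) (dec-map-dec T₁ S x) ⟨
        map P S (D (map P S (D x)))           ≡⟨ cong (map P S ∘ D) (decT-unfold T₁ T₂ x) ⟨
        map P S (D (decT T₁ T₂ x))            ≡⟨ decT-unfold T₁ T₂ (decT T₁ T₂ x) ⟨
        decT T₁ T₂ (decT T₁ T₂ x)             ∎

  _⊗_ : Decorated → Decorated → Decorated
  T₁ ⊗ T₂ = record { fun = fun T₁ ∘F fun T₂ ; dec = decT T₁ T₂ ; isDec = decT-isDecoration T₁ T₂ }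

  𝟙 : Decorated
  𝟙 = record
    { fun = IdF ; dec = decUnit
    ; isDec = record { dec-natural = λ _ _ → refl ; dec-extr = λ _ → refl ; dec-dup = λ _ → refl } }

  hcomp-isDecMor : (T₁ T₁' T₂ T₂' : Decorated) (ψ : DecMor T₁ T₁') (φ : DecMor T₂ T₂')
                 → IsDecMor (fun T₁ ∘F fun T₂) (fun T₁' ∘F fun T₂') (decT T₁ T₂) (decT T₁' T₂')
                            (hcomp (fun T₁) (fun T₁') (fun T₂) (fun T₂') (η ψ) (η φ))
  hcomp-isDecMor T₁ T₁' T₂ T₂' ψ φ = record
    { natural = hcomp-natural P P' (fun T₂) (fun T₂') (IsDecMor.natural (isMor ψ)) (IsDecMor.natural (isMor φ))
    ; dec-compat = compat }
    where
      P = fun T₁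
      P' = fun T₁'
      S : ∀ {A : Set} → W × F (fun T₂) A → F (fun T₂) (W × A)
      S = uncurry (shiftDec T₂)
      S' : ∀ {A : Set} → W × F (fun T₂') A → F (fun T₂') (W × A)
      S' = uncurry (shiftDec T₂')

      compat : ∀ {A : Set} (x : F P (F (fun T₂) A))
             → η ψ (map P (η φ) (decT T₁ T₂ x)) ≡ decT T₁' T₂' (η ψ (map P (η φ) x))
      compat x = begin
        η ψ (map P (η φ) (decT T₁ T₂ x))         ≡⟨ cong (η ψ ∘ map P (η φ)) (decT-unfold T₁ T₂ x) ⟩
        η ψ (map P (η φ) (map P S (dec T₁ x)))   ≡⟨ cong (η ψ) (map-∘ P (η φ) S (dec T₁ x)) ⟨
        η ψ (map P (η φ ∘ S) (dec T₁ x))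
          ≡⟨ cong (η ψ) (map-cong P (λ p → shiftDec-compat φ (proj₁ p) (proj₂ p)) (dec T₁ x)) ⟩
        η ψ (map P (S' ∘ Wmap (η φ)) (dec T₁ x)) ≡⟨ cong (η ψ) (map-∘ P S' (Wmap (η φ)) (dec T₁ x)) ⟩
        η ψ (map P S' (map P (Wmap (η φ)) (dec T₁ x)))
          ≡⟨ cong (η ψ ∘ map P S') (IsDecoration.dec-natural (isDec T₁) (η φ) x) ⟩
        η ψ (map P S' (dec T₁ (map P (η φ) x)))  ≡⟨ IsDecMor.natural (isMor ψ) S' _ ⟩
        map P' S' (η ψ (dec T₁ (map P (η φ) x))) ≡⟨ cong (map P' S') (IsDecMor.dec-compat (isMor ψ) _) ⟩
        map P' S' (dec T₁' (η ψ (map P (η φ) x))) ≡⟨ decT-unfold T₁' T₂' _ ⟨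
        decT T₁' T₂' (η ψ (map P (η φ) x))       ∎

  decT-unitˡ : LeftIdentity 1W _·_ → (T : Decorated) {A : Set} (x : F (fun T) A) → decT 𝟙 T x ≡ dec T x
  decT-unitˡ identityˡ T x = trans (decT-unfold 𝟙 T x) (shiftDec-identityˡ T identityˡ x)

  decT-unitʳ : RightIdentity 1W _·_ → (T : Decorated) {A : Set} (x : F (fun T) A) → decT T 𝟙 x ≡ dec T x
  decT-unitʳ identityʳ T x = begin
    decT T 𝟙 x                                 ≡⟨ decT-unfold T 𝟙 x ⟩
    map (fun T) (uncurry (shiftDec 𝟙)) (dec T x)
      ≡⟨ map-cong (fun T) (λ p → cong (_, proj₂ p) (identityʳ (proj₁ p))) (dec T x) ⟩
    map (fun T) id (dec T x)                   ≡⟨ map-id (fun T) (dec T x) ⟩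
    dec T x                                    ∎

  map-shiftDec-⊗ : Associative _·_ → (T₂ T₃ : Decorated) {A : Set} (w : W) (y : F (fun T₂) (F (fun T₃) A))
                 → map (fun T₂) (uncurry (shiftDec T₃)) (shiftDec T₂ w y) ≡ shiftDec (T₂ ⊗ T₃) w y
  map-shiftDec-⊗ assoc T₂ T₃ w y = begin
    map Q S₃ (map Q (map₁ (w ·_)) (dec T₂ y))     ≡⟨ map-∘ Q S₃ (map₁ (w ·_)) (dec T₂ y) ⟨
    map Q (S₃ ∘ map₁ (w ·_)) (dec T₂ y)
      ≡⟨ map-cong Q (λ p → map₁-shiftDec T₃ assoc w (proj₁ p) (proj₂ p)) (dec T₂ y) ⟨
    map Q (map R (map₁ (w ·_)) ∘ S₃) (dec T₂ y)  ≡⟨ map-∘ Q (map R (map₁ (w ·_))) S₃ (dec T₂ y) ⟩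
    map Q (map R (map₁ (w ·_))) (map Q S₃ (dec T₂ y)) ≡⟨ cong (map Q (map R (map₁ (w ·_)))) (decT-unfold T₂ T₃ y) ⟨
    map Q (map R (map₁ (w ·_))) (decT T₂ T₃ y)    ∎
    where
      Q = fun T₂
      R = fun T₃
      S₃ : ∀ {A : Set} → W × F R A → F R (W × A)
      S₃ = uncurry (shiftDec T₃)

  decT-assoc : Associative _·_ → (T₁ T₂ T₃ : Decorated) {A : Set} (x : F (fun T₁) (F (fun T₂) (F (fun T₃) A)))
             → decT (T₁ ⊗ T₂) T₃ x ≡ decT T₁ (T₂ ⊗ T₃) x
  decT-assoc assoc T₁ T₂ T₃ x = begin
    decT (T₁ ⊗ T₂) T₃ x                         ≡⟨ decT-unfold (T₁ ⊗ T₂) T₃ x ⟩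
    map P (map Q S₃) (decT T₁ T₂ x)             ≡⟨ cong (map P (map Q S₃)) (decT-unfold T₁ T₂ x) ⟩
    map P (map Q S₃) (map P S₂ (dec T₁ x))      ≡⟨ map-∘ P (map Q S₃) S₂ (dec T₁ x) ⟨
    map P (map Q S₃ ∘ S₂) (dec T₁ x)
      ≡⟨ map-cong P (λ p → map-shiftDec-⊗ assoc T₂ T₃ (proj₁ p) (proj₂ p)) (dec T₁ x) ⟩
    map P (uncurry (shiftDec (T₂ ⊗ T₃))) (dec T₁ x) ≡⟨ decT-unfold T₁ (T₂ ⊗ T₃) x ⟨
    decT T₁ (T₂ ⊗ T₃) x                         ∎
    where
      P = fun T₁
      Q = fun T₂
      S₂ : ∀ {A : Set} → W × F Q A → F Q (W × A)
      S₂ = uncurry (shiftDec T₂)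
      S₃ : ∀ {A : Set} → W × F (fun T₃) A → F (fun T₃) (W × A)
      S₃ = uncurry (shiftDec T₃)

lemma12 : (W : Set) (_·_ : W → W → W) (1W : W) → IsMonoid _≡_ _·_ 1W
        → DecW.IsStrictMonoidalDec W _·_ 1W
lemma12 W _·_ 1W isMonoid = record
  { unit-isDec   = isDec 𝟙
  ; tensor-isDec = decT-isDecoration
  ; tensor-mor   = hcomp-isDecMor
  ; tensor-id    = λ T₁ T₂ x → map-id (fun T₁) x
  ; tensor-∘     = λ T₁ T₁' T₁'' T₂ T₂' T₂'' ψ ψ' φ φ' →
      hcomp-interchange (fun T₁) (fun T₁') (fun T₁'') (fun T₂) (fun T₂') (fun T₂'')
                        (η ψ') (η φ) (η φ') (IsDecMor.natural (isMor ψ))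
  ; assoc        = decT-assoc ·-assoc
  ; unitˡ        = decT-unitˡ ·-identityˡ
  ; unitʳ        = decT-unitʳ ·-identityʳ
  ; assoc-mor    = λ T₁ T₁' T₂ T₂' T₃ T₃' ψ φ χ x → cong (η ψ) (sym (map-∘ (fun T₁) (η φ) (map (fun T₂) (η χ)) x))
  ; unitˡ-mor    = λ T T' ψ x → refl
  ; unitʳ-mor    = λ T T' ψ x → cong (η ψ) (map-id (fun T) x)
  }
  where
    open Decorations W _·_ 1W
    open IsMonoid isMonoid using () renaming (assoc to ·-assoc; identityˡ to ·-identityˡ; identityʳ to ·-identityʳ)
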